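{- Let $z_0\ge2$, $z\ge1$ and $\tau$ a positive integer coprime to $P(z_0)$. For every prime $p$, $$-1\le w_p(z;z_0,\tau)\,G_\tau(z;z_0)\,(p-1)\le0.$$
   Context: $\mu$ is the Möbius function, $\varphi$ Euler's totient, $P(z_0)=\prod_{p<z_0}p$. For a positive integer $d$ and $y>0$, $G_d(y;z_0)=\sum_{\ell\le y,\,(\ell,dP(z_0))=1}\mu^2(\ell)/\varphi(\ell)$. Let $\varphi_2(n)=\prod_{p\mid n}(p-2)$. For squarefree $q$ and $y>0$, $\xi_q(y)=\sum_{q_1q_2q_3=q,\ q_1q_3\le y,\ q_2q_3\le y}\mu(q_3)\varphi_2(q_3)/\varphi(q_3)$, and $G_{[q]}(z;z_0,\tau)=\sum_{\ell\le z/\sqrt q,\,(\ell,q\tau P(z_0))=1}\frac{\mu^2(\ell)}{\varphi(\ell)}\xi_q(z/\ell)$. For $q$ squarefree and coprime to $\tau P(z_0)$, $w_q(z;z_0,\tau)=\frac{\mu(q)}{\varphi(q)G_\tau(z;z_0)}\cdot\frac{G_{[q]}(z;z_0,\tau)}{G_\tau(z;z_0)}$; for all other $q$, $w_q(z;z_0,\tau)=0$.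
   Formalization: The parameters z₀ and z range over the rationals instead of the reals. -}

module Defs where

open import Data.Bool using (Bool; true; false; if_then_else_; not; T; _∧_)
open import Data.Bool.Properties using (T?)
open import Data.Nat as ℕ using (ℕ; zero; suc)
open import Data.Nat.Divisibility using (_∣?_)
open import Data.Nat.Coprimality using (coprime?)
open import Data.Nat.Primality using (prime?)
open import Data.Integer as ℤ using (ℤ; +_)
open import Data.Rational as ℚ using (ℚ; 0ℚ; 1ℚ; _/_; _÷_; floor; ceiling)
open import Data.Rational.Properties as ℚP using (_≤?_; _<?_)
open import Data.List using (List; []; _∷_; map; filter; length; foldr; upTo)
open import Data.Product using (_×_)
open import Relation.Nullary using (Dec; yes; no; ¬_)
open import Relation.Nullary.Decidable using (does; _×-dec_)
open import Relation.Binary.PropositionalEquality using (_≡_)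

ℕ→ℚ : ℕ → ℚ
ℕ→ℚ n = (+ n) / 1

ℤ→ℚ : ℤ → ℚ
ℤ→ℚ i = i / 1

-- total division on ℚ; division by 0 returns 0 (never used: every
-- denominator below is a value of φ (≥ 1 on positive integers) or of G_τ (≥ 1))
_÷′_ : ℚ → ℚ → ℚ
p ÷′ q with q ℚP.≟ 0ℚ
... | yes _  = 0ℚ
... | no q≢0 = _÷_ p q {{ℚ.≢-nonZero q≢0}}

ind : ∀ {a} {P : Set a} → Dec P → ℚ → ℚ
ind (yes _) x = x
ind (no _)  x = 0ℚ

range1 : ℕ → List ℕ
range1 n = map suc (upTo n)

sumTo : ℕ → (ℕ → ℚ) → ℚ
sumTo n f = foldr (λ k acc → f k ℚ.+ acc) 0ℚ (range1 n)

productℕ : List ℕ → ℕ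
productℕ = foldr ℕ._*_ 1

primeDivisors : ℕ → List ℕ
primeDivisors n = filter (λ p → prime? p ×-dec (p ∣? n)) (range1 n)

-- n is squarefree (for n ≥ 1): no d ≥ 2 with d² ∣ n (such d satisfies d ≤ n)
squarefreeᵇ : ℕ → Bool
squarefreeᵇ n = foldr (λ d b → not (does ((suc (suc d) ℕ.* suc (suc d)) ∣? n)) ∧ b) true (upTo n)

SquareFree : ℕ → Set
SquareFree n = T (squarefreeᵇ n)

squarefree? : (n : ℕ) → Dec (SquareFree n)
squarefree? n = T? (squarefreeᵇ n)

negOnePow : ℕ → ℤ
negOnePow zero    = + 1
negOnePow (suc k) = ℤ.- negOnePow k

μ : ℕ → ℤ
μ n = if squarefreeᵇ n then negOnePow (length (primeDivisors n)) else + 0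

φ : ℕ → ℕ
φ n = length (filter (λ k → coprime? k n) (range1 n))

φ₂ : ℕ → ℕ
φ₂ n = productℕ (map (λ p → p ℕ.∸ 2) (primeDivisors n))

-- P(z₀) = ∏_{p < z₀} p   (z₀ rational; primes p < z₀ satisfy p ≤ ⌈z₀⌉)
P : ℚ → ℕ
P z₀ = productℕ (filter (λ p → prime? p ×-dec (ℕ→ℚ p <? z₀)) (upTo (suc ℤ.∣ ceiling z₀ ∣)))

μ²/φ : ℕ → ℚ
μ²/φ ℓ = ℤ→ℚ (μ ℓ ℤ.* μ ℓ) ÷′ ℕ→ℚ (φ ℓ)

G : ℕ → ℚ → ℚ → ℚ
G d y z₀ = sumTo ℤ.∣ floor y ∣ (λ ℓ →
  ind (ℕ→ℚ ℓ ≤? y) (ind (coprime? ℓ (d ℕ.* P z₀)) (μ²/φ ℓ)))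

ξ : ℕ → ℚ → ℚ
ξ q y = sumTo q (λ q₁ → sumTo q (λ q₂ → sumTo q (λ q₃ →
  ind (q₁ ℕ.* q₂ ℕ.* q₃ ℕ.≟ q)
    (ind (ℕ→ℚ (q₁ ℕ.* q₃) ≤? y)
      (ind (ℕ→ℚ (q₂ ℕ.* q₃) ≤? y)
        ((ℤ→ℚ (μ q₃) ℚ.* ℕ→ℚ (φ₂ q₃)) ÷′ ℕ→ℚ (φ q₃)))))))

-- G_[q](z; z₀, τ) = Σ_{ℓ ≤ z/√q, (ℓ, q τ P(z₀)) = 1} μ²(ℓ)/φ(ℓ) · ξ_q(z/ℓ)
-- the condition ℓ ≤ z/√q (ℓ ≥ 1, q ≥ 1) is written exactly as 0 ≤ z ∧ ℓ²q ≤ z²;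
-- such ℓ satisfy ℓ ≤ z, so ℓ ranges over [1, ⌊z⌋].
G[_] : ℕ → ℚ → ℚ → ℕ → ℚ
G[ q ] z z₀ τ = sumTo ℤ.∣ floor z ∣ (λ ℓ →
  ind ((0ℚ ≤? z) ×-dec (ℕ→ℚ (ℓ ℕ.* ℓ ℕ.* q) ≤? z ℚ.* z))
    (ind (coprime? ℓ (q ℕ.* τ ℕ.* P z₀))
      (μ²/φ ℓ ℚ.* ξ q (z ÷′ ℕ→ℚ ℓ))))

w : ℕ → ℚ → ℚ → ℕ → ℚ
w q z z₀ τ =
  ind (squarefree? q ×-dec coprime? q (τ ℕ.* P z₀))
    ((ℤ→ℚ (μ q) ÷′ (ℕ→ℚ (φ q) ℚ.* G τ z z₀)) ℚ.* (G[ q ] z z₀ τ ÷′ G τ z z₀))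

{-# OPTIONS --safe #-}
module Submission where

-- If p divides τP(z₀) the weight w_p vanishes. Otherwise μ(p) = −1 and φ(p) = p − 1 give
-- w_p G_τ (p − 1) = −G_[p]/G_τ, so it suffices that 0 ≤ G_[p] ≤ G_τ. Only the factorisations
-- p·1·1, 1·p·1 and 1·1·p of p contribute to ξ_p, whence ξ_p(y) = [p ≤ y] (1 + 1/(p − 1)).
-- Hence the ℓ-th term of G_[p] vanishes unless pℓ ≤ z, and then it is
-- μ²(ℓ)/φ(ℓ) + μ²(ℓ)/((p − 1)φ(ℓ)) ≤ μ²(ℓ)/φ(ℓ) + μ²(pℓ)/φ(pℓ), because φ(pℓ) ≤ (p − 1)φ(ℓ)
-- and pℓ is squarefree with ℓ. These are the terms of G_τ at ℓ and pℓ, and the pairs {ℓ, pℓ}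
-- with p ∤ ℓ are disjoint.

open import Defs
open import Data.Bool using (T; true; not; _∧_)
open import Data.Bool.Properties using (T-≡; T-∧; T-not-≡; ¬-not)
open import Data.Empty using (⊥)
open import Data.Integer as ℤ using (+_; -[1+_])
import Data.Integer.DivMod as ℤDivMod
import Data.Integer.Properties as ℤP
open import Data.List using ([]; _∷_; _++_; map; foldr; filter; length; upTo)
import Data.List.Properties as LP
open import Data.List.Membership.Propositional using (_∈_)
open import Data.List.Membership.Propositional.Properties using (∈-upTo⁺)
open import Data.List.Relation.Unary.All using (All)
import Data.List.Relation.Unary.All.Properties as AllP
open import Data.List.Relation.Unary.Any using (here; there)
open import Data.Nat as ℕ using (ℕ; zero; suc; z≤n; s≤s)
open import Data.Nat.Coprimality as Coprimality using (Coprime; coprime?)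
open import Data.Nat.Divisibility
  using ( _∣_; _∣?_; divides; ∣-refl; ∣-trans; ∣⇒≤; ∣m∣n⇒∣m+n; ∣m⇒∣m*n; ∣n⇒∣m*n; m∣m*n; n∣m*n; m*n∣⇒m∣
        ; *-pres-∣; *-cancelˡ-∣)
open import Data.Nat.DivMod using (m*n/n≡m; /-monoˡ-≤)
open import Data.Nat.Primality using (Prime; prime?; prime⇒irreducible; prime⇒nonTrivial; prime⇒nonZero; euclidsLemma)
import Data.Nat.Properties as ℕP
open import Data.Nat.Solver using () renaming (module +-*-Solver to ℕ-Solver)
open import Data.Product using (_×_; _,_; proj₁; proj₂)
open import Data.Rational as ℚ using (ℚ; 0ℚ; 1ℚ; -_; _≤_; _<_; _*_; _+_; _-_)
import Data.Rational.Properties as ℚP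
open import Data.Rational.Solver using (module +-*-Solver)
open import Data.Sum using (inj₁; inj₂)
open import Function using (_∘_; id; case_of_)
open import Function.Bundles using (_⇔_; mk⇔; Equivalence)
open import Relation.Binary.Definitions using (tri<; tri≈; tri>)
open import Relation.Binary.PropositionalEquality using (_≡_; _≢_; refl; sym; trans; cong; cong₂; subst; subst₂; module ≡-Reasoning)
open import Relation.Nullary using (Dec; yes; no; ¬_; ¬?; contradiction)
open import Relation.Nullary.Decidable using (_×-dec_; does; dec-true; dec-false)

ℕ→ℚ≡mkℚ : ∀ n → ℕ→ℚ n ≡ ℚ.mkℚ (+ n) 0 (Coprimality.sym (Coprimality.1-coprimeTo n))
ℕ→ℚ≡mkℚ n = ℚP.normalize-coprime (Coprimality.sym (Coprimality.1-coprimeTo n))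

ℕ→ℚ-mono-≤ : ∀ {m n} → m ℕ.≤ n → ℕ→ℚ m ≤ ℕ→ℚ n
ℕ→ℚ-mono-≤ {m} {n} m≤n rewrite ℕ→ℚ≡mkℚ m | ℕ→ℚ≡mkℚ n =
  ℚ.*≤* (subst₂ ℤ._≤_ (sym (ℤP.*-identityʳ (+ m))) (sym (ℤP.*-identityʳ (+ n))) (ℤ.+≤+ m≤n))

ℕ→ℚ-homo-+ : ∀ m n → ℕ→ℚ (m ℕ.+ n) ≡ ℕ→ℚ m + ℕ→ℚ n
ℕ→ℚ-homo-+ m n rewrite ℕ→ℚ≡mkℚ m | ℕ→ℚ≡mkℚ n =
  cong (ℚ._/ 1) (sym (cong₂ ℤ._+_ (ℤP.*-identityʳ (+ m)) (ℤP.*-identityʳ (+ n))))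

ℕ→ℚ-homo-* : ∀ m n → ℕ→ℚ (m ℕ.* n) ≡ ℕ→ℚ m * ℕ→ℚ n
ℕ→ℚ-homo-* m n rewrite ℕ→ℚ≡mkℚ m | ℕ→ℚ≡mkℚ n = cong (ℚ._/ 1) (ℤP.pos-* m n)

ℕ→ℚ-pos : ∀ {n} → 1 ℕ.≤ n → 0ℚ < ℕ→ℚ n
ℕ→ℚ-pos {suc n} _ rewrite ℕ→ℚ≡mkℚ (suc n) = ℚ.*<* (ℤ.+<+ (s≤s z≤n))

ℕ→ℚ-nonNeg : ∀ n → 0ℚ ≤ ℕ→ℚ n
ℕ→ℚ-nonNeg n = ℕ→ℚ-mono-≤ {0} {n} z≤n

≤⇒≤∣floor∣ : ∀ n z → ℕ→ℚ n ≤ z → n ℕ.≤ ℤ.∣ ℚ.floor z ∣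
≤⇒≤∣floor∣ n (ℚ.mkℚ (+ a) d _) n≤z rewrite ℕ→ℚ≡mkℚ n with n≤z
... | ℚ.*≤* n[d+1]≤a =
  subst (n ℕ.≤_) (cong ℤ.∣_∣ (sym (ℤDivMod.div-pos-is-/ℕ (+ a) (suc d))))
    (subst (ℕ._≤ a ℕ./ suc d) (m*n/n≡m n (suc d)) (/-monoˡ-≤ (suc d)
      (ℤP.drop‿+≤+ (subst₂ ℤ._≤_ (sym (ℤP.pos-* n (suc d))) (ℤP.*-identityʳ (+ a)) n[d+1]≤a))))
≤⇒≤∣floor∣ n (ℚ.mkℚ -[1+ a ] d _) n≤z rewrite ℕ→ℚ≡mkℚ n with n≤z
... | ℚ.*≤* n[d+1]≤-a = contradiction
  (subst (ℤ._≤ -[1+ a ] ℤ.* + 1) (sym (ℤP.pos-* n (suc d))) n[d+1]≤-a)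
  (ℤP.<⇒≱ (ℤP.<-≤-trans ℤ.-<+ (ℤ.+≤+ z≤n)))

0≤1 : 0ℚ ≤ 1ℚ
0≤1 = ℚP.<⇒≤ (ℚP.positive⁻¹ 1ℚ)

*-nonNeg : ∀ {x y} → 0ℚ ≤ x → 0ℚ ≤ y → 0ℚ ≤ x * y
*-nonNeg {x} {y} 0≤x 0≤y =
  ℚP.nonNegative⁻¹ (x * y) {{ℚP.nonNeg*nonNeg⇒nonNeg x {{ℚ.nonNegative 0≤x}} y {{ℚ.nonNegative 0≤y}}}}

+-cancelˡ-≤ : ∀ z {x y} → z + x ≤ z + y → x ≤ y
+-cancelˡ-≤ z {x} {y} z+x≤z+y = begin
  x                ≡⟨ solve 2 (λ z x → x := (:- z) :+ (z :+ x)) refl z x ⟩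
  - z + (z + x)    ≤⟨ ℚP.+-monoʳ-≤ (- z) z+x≤z+y ⟩
  - z + (z + y)    ≡⟨ solve 2 (λ z y → (:- z) :+ (z :+ y) := y) refl z y ⟩
  y                ∎
  where
  open ℚP.≤-Reasoning
  open +-*-Solver

÷′≡*1÷′ : ∀ p q → p ÷′ q ≡ p * (1ℚ ÷′ q)
÷′≡*1÷′ p q with q ℚP.≟ 0ℚ
... | yes _ = sym (ℚP.*-zeroʳ p)
... | no _  = cong (p *_) (sym (ℚP.*-identityˡ _))

*-1÷′-inverseʳ : ∀ {q} → q ≢ 0ℚ → q * (1ℚ ÷′ q) ≡ 1ℚ
*-1÷′-inverseʳ {q} q≢0 with q ℚP.≟ 0ℚ
... | yes q≡0 = contradiction q≡0 q≢0
... | no q≢0′ = trans (cong (q *_) (ℚP.*-identityˡ _)) (ℚP.*-inverseʳ q {{ℚ.≢-nonZero q≢0′}})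

÷′-*-cancel : ∀ x {q} → q ≢ 0ℚ → (x ÷′ q) * q ≡ x
÷′-*-cancel x {q} q≢0 = begin
  (x ÷′ q) * q          ≡⟨ cong (_* q) (÷′≡*1÷′ x q) ⟩
  x * (1ℚ ÷′ q) * q     ≡⟨ ℚP.*-assoc x (1ℚ ÷′ q) q ⟩
  x * ((1ℚ ÷′ q) * q)   ≡⟨ cong (x *_) (trans (ℚP.*-comm (1ℚ ÷′ q) q) (*-1÷′-inverseʳ q≢0)) ⟩
  x * 1ℚ                ≡⟨ ℚP.*-identityʳ x ⟩
  x                     ∎
  where open ≡-Reasoning

1÷′-pos : ∀ {q} → 0ℚ < q → 0ℚ < 1ℚ ÷′ q
1÷′-pos {q} 0<q with q ℚP.≟ 0ℚ
... | yes q≡0 = contradiction (sym q≡0) (ℚP.<⇒≢ 0<q)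
... | no q≢0 = subst (0ℚ <_) (sym (ℚP.*-identityˡ 1/q)) (ℚP.positive⁻¹ 1/q {{ℚP.1/pos⇒pos q {{ℚ.positive 0<q}}}})
  where 1/q = (ℚ.1/ q) {{ℚ.≢-nonZero q≢0}}

1÷′-nonNeg : ∀ {q} → 0ℚ ≤ q → 0ℚ ≤ 1ℚ ÷′ q
1÷′-nonNeg {q} 0≤q with ℚP.<-cmp 0ℚ q
... | tri< 0<q _ _ = ℚP.<⇒≤ (1÷′-pos 0<q)
... | tri≈ _ refl _ = ℚP.≤-refl
... | tri> _ _ q<0 = contradiction (ℚP.<-≤-trans q<0 0≤q) (ℚP.<-irrefl refl)

1÷′-antimono-≤ : ∀ {p q} → 0ℚ < p → p ≤ q → 1ℚ ÷′ q ≤ 1ℚ ÷′ p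
1÷′-antimono-≤ {p} {q} 0<p p≤q = begin
  1/q                  ≡⟨ sym (ℚP.*-identityʳ 1/q) ⟩
  1/q * 1ℚ             ≡⟨ cong (1/q *_) (sym (*-1÷′-inverseʳ p≢0)) ⟩
  1/q * (p * 1/p)      ≤⟨ ℚP.*-monoˡ-≤-nonNeg 1/q {{ℚ.nonNegative (1÷′-nonNeg 0≤q)}}
                            (ℚP.*-monoʳ-≤-nonNeg 1/p {{ℚ.nonNegative (1÷′-nonNeg (ℚP.<⇒≤ 0<p))}} p≤q) ⟩
  1/q * (q * 1/p)      ≡⟨ sym (ℚP.*-assoc 1/q q 1/p) ⟩
  1/q * q * 1/p        ≡⟨ cong (_* 1/p) (trans (ℚP.*-comm 1/q q) (*-1÷′-inverseʳ q≢0)) ⟩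
  1ℚ * 1/p             ≡⟨ ℚP.*-identityˡ 1/p ⟩
  1/p                  ∎
  where
  open ℚP.≤-Reasoning
  1/p = 1ℚ ÷′ p
  1/q = 1ℚ ÷′ q
  0≤q = ℚP.≤-trans (ℚP.<⇒≤ 0<p) p≤q
  p≢0 = ℚP.<⇒≢ 0<p ∘ sym
  q≢0 = ℚP.<⇒≢ (ℚP.<-≤-trans 0<p p≤q) ∘ sym

1÷′-distrib-* : ∀ p q → 1ℚ ÷′ (p * q) ≡ (1ℚ ÷′ p) * (1ℚ ÷′ q)
1÷′-distrib-* p q with 0ℚ ℚP.≟ p | 0ℚ ℚP.≟ q
... | yes refl | _ = trans (cong (1ℚ ÷′_) (ℚP.*-zeroˡ q)) (sym (ℚP.*-zeroˡ (1ℚ ÷′ q)))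
... | no _ | yes refl = trans (cong (1ℚ ÷′_) (ℚP.*-zeroʳ p)) (sym (ℚP.*-zeroʳ (1ℚ ÷′ p)))
... | no 0≢p | no 0≢q = begin
  1/pq                   ≡⟨ sym (ℚP.*-identityʳ 1/pq) ⟩
  1/pq * 1ℚ              ≡⟨ cong (1/pq *_) (sym pq[1/p1/q]≡1) ⟩
  1/pq * (p * q * 1/p1/q) ≡⟨ sym (ℚP.*-assoc 1/pq (p * q) 1/p1/q) ⟩
  1/pq * (p * q) * 1/p1/q ≡⟨ cong (_* 1/p1/q) (trans (ℚP.*-comm 1/pq (p * q)) (*-1÷′-inverseʳ pq≢0)) ⟩
  1ℚ * 1/p1/q            ≡⟨ ℚP.*-identityˡ 1/p1/q ⟩
  1/p1/q                 ∎
  where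
  open ≡-Reasoning
  1/pq = 1ℚ ÷′ (p * q)
  1/p1/q = (1ℚ ÷′ p) * (1ℚ ÷′ q)
  pq[1/p1/q]≡1 : p * q * 1/p1/q ≡ 1ℚ
  pq[1/p1/q]≡1 = begin
    p * q * ((1ℚ ÷′ p) * (1ℚ ÷′ q))
      ≡⟨ solve 4 (λ p q p′ q′ → p :* q :* (p′ :* q′) := (p :* p′) :* (q :* q′)) refl p q (1ℚ ÷′ p) (1ℚ ÷′ q) ⟩
    (p * (1ℚ ÷′ p)) * (q * (1ℚ ÷′ q)) ≡⟨ cong₂ _*_ (*-1÷′-inverseʳ (0≢p ∘ sym)) (*-1÷′-inverseʳ (0≢q ∘ sym)) ⟩
    1ℚ ∎
    where open +-*-Solver
  pq≢0 : p * q ≢ 0ℚ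
  pq≢0 pq≡0 = ℚP.1≢0 (trans (sym pq[1/p1/q]≡1) (trans (cong (_* 1/p1/q) pq≡0) (ℚP.*-zeroˡ 1/p1/q)))

÷′-bounded : ∀ {p q} → 0ℚ ≤ p → p ≤ q → (0ℚ ≤ p ÷′ q) × (p ÷′ q ≤ 1ℚ)
÷′-bounded {p} {q} 0≤p p≤q rewrite ÷′≡*1÷′ p q with ℚP.<-cmp 0ℚ q
... | tri< 0<q _ _ =
  *-nonNeg 0≤p 0≤1/q ,
  ℚP.≤-trans (ℚP.*-monoʳ-≤-nonNeg (1ℚ ÷′ q) {{ℚ.nonNegative 0≤1/q}} p≤q) (ℚP.≤-reflexive (*-1÷′-inverseʳ (ℚP.<⇒≢ 0<q ∘ sym)))
  where 0≤1/q = 1÷′-nonNeg (ℚP.<⇒≤ 0<q)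
... | tri≈ _ refl _ = ℚP.≤-reflexive (sym (ℚP.*-zeroʳ p)) , ℚP.≤-trans (ℚP.≤-reflexive (ℚP.*-zeroʳ p)) 0≤1
... | tri> _ _ q<0 = contradiction (ℚP.<-≤-trans q<0 (ℚP.≤-trans 0≤p p≤q)) (ℚP.<-irrefl refl)

ind-true : ∀ {a} {A : Set a} (A? : Dec A) {x} → A → ind A? x ≡ x
ind-true (yes _) _ = refl
ind-true (no ¬a) a = contradiction a ¬a

ind-false : ∀ {a} {A : Set a} (A? : Dec A) {x} → ¬ A → ind A? x ≡ 0ℚ
ind-false (yes a) ¬a = contradiction a ¬a
ind-false (no _)  _  = refl

ind-nonNeg : ∀ {a} {A : Set a} (A? : Dec A) {x} → 0ℚ ≤ x → 0ℚ ≤ ind A? x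
ind-nonNeg (yes _) 0≤x = 0≤x
ind-nonNeg (no _)  _   = ℚP.≤-refl

ind-≤ : ∀ {a} {A : Set a} (A? : Dec A) {x} → 0ℚ ≤ x → ind A? x ≤ x
ind-≤ (yes _) _   = ℚP.≤-refl
ind-≤ (no _)  0≤x = 0≤x

ind-zero : ∀ {a} {A : Set a} (A? : Dec A) → ind A? 0ℚ ≡ 0ℚ
ind-zero (yes _) = refl
ind-zero (no _)  = refl

ind-complement : ∀ {a} {A : Set a} (A? : Dec A) x → ind (¬? A?) x + ind A? x ≡ x
ind-complement (yes _) x = ℚP.+-identityˡ x
ind-complement (no _)  x = ℚP.+-identityʳ x

ind-cong : ∀ {a b} {A : Set a} {B : Set b} → A ⇔ B → (A? : Dec A) (B? : Dec B) {x : ℚ} → ind A? x ≡ ind B? x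
ind-cong A⇔B (yes _) (yes _) = refl
ind-cong A⇔B (yes a) (no ¬b) = contradiction (Equivalence.to A⇔B a) ¬b
ind-cong A⇔B (no ¬a) (yes b) = contradiction (Equivalence.from A⇔B b) ¬a
ind-cong A⇔B (no _)  (no _)  = refl

ind-≤?-suc : ∀ m n x → ind (m ℕ.≤? suc n) x ≡ ind (m ℕ.≤? n) x + ind (m ℕ.≟ suc n) x
ind-≤?-suc m n x with m ℕ.≤? suc n | m ℕ.≤? n | m ℕ.≟ suc n
... | yes _   | yes m≤n | yes refl = contradiction m≤n (ℕP.<-irrefl refl)
... | yes _   | yes _   | no _     = sym (ℚP.+-identityʳ x)
... | yes _   | no _    | yes _    = sym (ℚP.+-identityˡ x)
... | yes m≤1+n | no m≰n | no m≢1+n = contradiction (ℕP.≤-antisym m≤1+n (ℕP.≰⇒> m≰n)) m≢1+n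
... | no m≰1+n | yes m≤n | _       = contradiction (ℕP.m≤n⇒m≤1+n m≤n) m≰1+n
... | no m≰1+n | no _   | yes refl = contradiction ℕP.≤-refl m≰1+n
... | no _    | no _    | no _     = refl

range1-suc : ∀ n → range1 (suc n) ≡ range1 n ++ suc n ∷ []
range1-suc n = trans (cong (map suc) (sym (LP.upTo-∷ʳ n))) (LP.map-++ suc (upTo n) (n ∷ []))

sumTo-suc : ∀ n f → sumTo (suc n) f ≡ sumTo n f + f (suc n)
sumTo-suc n f = trans (cong (foldr step 0ℚ) (range1-suc n)) (foldr-∷ʳ (range1 n))
  where
  step = λ k acc → f k + acc
  foldr-∷ʳ : ∀ xs → foldr step 0ℚ (xs ++ suc n ∷ []) ≡ foldr step 0ℚ xs + f (suc n)
  foldr-∷ʳ []       = trans (ℚP.+-identityʳ (f (suc n))) (sym (ℚP.+-identityˡ (f (suc n))))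
  foldr-∷ʳ (x ∷ xs) = trans (cong (ℚ._+_ (f x)) (foldr-∷ʳ xs)) (sym (ℚP.+-assoc (f x) _ _))

sumTo-cong : ∀ n {f g} → (∀ k → f k ≡ g k) → sumTo n f ≡ sumTo n g
sumTo-cong zero    f≗g = refl
sumTo-cong (suc n) {f} {g} f≗g = begin
  sumTo (suc n) f       ≡⟨ sumTo-suc n f ⟩
  sumTo n f + f (suc n) ≡⟨ cong₂ _+_ (sumTo-cong n f≗g) (f≗g (suc n)) ⟩
  sumTo n g + g (suc n) ≡⟨ sumTo-suc n g ⟨
  sumTo (suc n) g       ∎
  where open ≡-Reasoning

sumTo-zero : ∀ n {f} → (∀ k → f k ≡ 0ℚ) → sumTo n f ≡ 0ℚ
sumTo-zero zero    f≗0 = refl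
sumTo-zero (suc n) {f} f≗0 = begin
  sumTo (suc n) f       ≡⟨ sumTo-suc n f ⟩
  sumTo n f + f (suc n) ≡⟨ cong₂ _+_ (sumTo-zero n f≗0) (f≗0 (suc n)) ⟩
  0ℚ                    ∎
  where open ≡-Reasoning

sumTo-distrib-+ : ∀ n f g → sumTo n (λ k → f k + g k) ≡ sumTo n f + sumTo n g
sumTo-distrib-+ zero    f g = refl
sumTo-distrib-+ (suc n) f g = begin
  sumTo (suc n) (λ k → f k + g k)                      ≡⟨ sumTo-suc n (λ k → f k + g k) ⟩
  sumTo n (λ k → f k + g k) + (f (suc n) + g (suc n))  ≡⟨ cong (_+ (f (suc n) + g (suc n))) (sumTo-distrib-+ n f g) ⟩
  sumTo n f + sumTo n g + (f (suc n) + g (suc n))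
    ≡⟨ solve 4 (λ a b c d → a :+ b :+ (c :+ d) := a :+ c :+ (b :+ d)) refl
                                                            (sumTo n f) (sumTo n g) (f (suc n)) (g (suc n)) ⟩
  sumTo n f + f (suc n) + (sumTo n g + g (suc n))      ≡⟨ cong₂ _+_ (sumTo-suc n f) (sumTo-suc n g) ⟨
  sumTo (suc n) f + sumTo (suc n) g                    ∎
  where
  open ≡-Reasoning
  open +-*-Solver

sumTo-mono-≤ : ∀ n {f g} → (∀ {k} → 1 ℕ.≤ k → k ℕ.≤ n → f k ≤ g k) → sumTo n f ≤ sumTo n g
sumTo-mono-≤ zero    f≤g = ℚP.≤-refl
sumTo-mono-≤ (suc n) {f} {g} f≤g = begin
  sumTo (suc n) f       ≡⟨ sumTo-suc n f ⟩
  sumTo n f + f (suc n) ≤⟨ ℚP.+-mono-≤ (sumTo-mono-≤ n (λ 1≤k k≤n → f≤g 1≤k (ℕP.m≤n⇒m≤1+n k≤n)))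
                                       (f≤g (s≤s z≤n) ℕP.≤-refl) ⟩
  sumTo n g + g (suc n) ≡⟨ sumTo-suc n g ⟨
  sumTo (suc n) g       ∎
  where open ℚP.≤-Reasoning

sumTo-nonNeg : ∀ n {f} → (∀ {k} → 1 ℕ.≤ k → k ℕ.≤ n → 0ℚ ≤ f k) → 0ℚ ≤ sumTo n f
sumTo-nonNeg n {f} 0≤f = subst (_≤ sumTo n f) (sumTo-zero n (λ _ → refl)) (sumTo-mono-≤ n 0≤f)

sumTo-point : ∀ n {a} c → 1 ℕ.≤ a → sumTo n (λ k → ind (a ℕ.≟ k) c) ≡ ind (a ℕ.≤? n) c
sumTo-point zero    {suc a} c _ = refl
sumTo-point (suc n) {a}     c 1≤a = begin
  sumTo (suc n) (λ k → ind (a ℕ.≟ k) c)                 ≡⟨ sumTo-suc n (λ k → ind (a ℕ.≟ k) c) ⟩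
  sumTo n (λ k → ind (a ℕ.≟ k) c) + ind (a ℕ.≟ suc n) c ≡⟨ cong (_+ ind (a ℕ.≟ suc n) c) (sumTo-point n c 1≤a) ⟩
  ind (a ℕ.≤? n) c + ind (a ℕ.≟ suc n) c                ≡⟨ ind-≤?-suc a n c ⟨
  ind (a ℕ.≤? suc n) c                                  ∎
  where open ≡-Reasoning

sumTo-single : ∀ n {a} f → 1 ℕ.≤ a → a ℕ.≤ n → (∀ k → k ≢ a → f k ≡ 0ℚ) → sumTo n f ≡ f a
sumTo-single n {a} f 1≤a a≤n f≡0 = begin
  sumTo n f                        ≡⟨ sumTo-cong n isolate ⟩
  sumTo n (λ k → ind (a ℕ.≟ k) (f a)) ≡⟨ sumTo-point n (f a) 1≤a ⟩
  ind (a ℕ.≤? n) (f a)             ≡⟨ ind-true (a ℕ.≤? n) a≤n ⟩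
  f a                              ∎
  where
  open ≡-Reasoning
  isolate : ∀ k → f k ≡ ind (a ℕ.≟ k) (f a)
  isolate k with a ℕ.≟ k
  ... | yes refl = refl
  ... | no a≢k   = f≡0 k (a≢k ∘ sym)

sumTo-pair : ∀ {a b} f → 1 ℕ.≤ a → a ℕ.< b → (∀ k → k ≢ a → k ≢ b → f k ≡ 0ℚ) → sumTo b f ≡ f a + f b
sumTo-pair {a} {b} f 1≤a a<b f≡0 = begin
  sumTo b f                                                              ≡⟨ sumTo-cong b isolate ⟩
  sumTo b (λ k → ind (a ℕ.≟ k) (f a) + ind (b ℕ.≟ k) (f b))
    ≡⟨ sumTo-distrib-+ b (λ k → ind (a ℕ.≟ k) (f a)) (λ k → ind (b ℕ.≟ k) (f b)) ⟩
  sumTo b (λ k → ind (a ℕ.≟ k) (f a)) + sumTo b (λ k → ind (b ℕ.≟ k) (f b))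
    ≡⟨ cong₂ _+_ (sumTo-point b (f a) 1≤a) (sumTo-point b (f b) (ℕP.≤-trans 1≤a (ℕP.<⇒≤ a<b))) ⟩
  ind (a ℕ.≤? b) (f a) + ind (b ℕ.≤? b) (f b)
    ≡⟨ cong₂ _+_ (ind-true (a ℕ.≤? b) (ℕP.<⇒≤ a<b)) (ind-true (b ℕ.≤? b) ℕP.≤-refl) ⟩
  f a + f b                                                              ∎
  where
  open ≡-Reasoning
  isolate : ∀ k → f k ≡ ind (a ℕ.≟ k) (f a) + ind (b ℕ.≟ k) (f b)
  isolate k with a ℕ.≟ k | b ℕ.≟ k
  ... | yes refl | yes refl = contradiction a<b (ℕP.<-irrefl refl)
  ... | yes refl | no _     = sym (ℚP.+-identityʳ (f k))
  ... | no _     | yes refl = sym (ℚP.+-identityˡ (f k))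
  ... | no a≢k   | no b≢k   = f≡0 k (a≢k ∘ sym) (b≢k ∘ sym)

sumTo-+ : ∀ m n (f : ℕ → ℚ) → sumTo (m ℕ.+ n) f ≡ sumTo m f + sumTo n (λ k → f (m ℕ.+ k))
sumTo-+ m zero f = trans (cong (λ n → sumTo n f) (ℕP.+-identityʳ m)) (sym (ℚP.+-identityʳ (sumTo m f)))
sumTo-+ m (suc n) f = begin
  sumTo (m ℕ.+ suc n) f                                               ≡⟨ cong (λ k → sumTo k f) (ℕP.+-suc m n) ⟩
  sumTo (suc (m ℕ.+ n)) f                                             ≡⟨ sumTo-suc (m ℕ.+ n) f ⟩
  sumTo (m ℕ.+ n) f + f (suc (m ℕ.+ n))
    ≡⟨ cong₂ _+_ (sumTo-+ m n f) (cong f (sym (ℕP.+-suc m n))) ⟩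
  sumTo m f + sumTo n (λ k → f (m ℕ.+ k)) + f (m ℕ.+ suc n)
    ≡⟨ ℚP.+-assoc (sumTo m f) (sumTo n (λ k → f (m ℕ.+ k))) (f (m ℕ.+ suc n)) ⟩
  sumTo m f + (sumTo n (λ k → f (m ℕ.+ k)) + f (m ℕ.+ suc n))
    ≡⟨ cong (ℚ._+_ (sumTo m f)) (sumTo-suc n (λ k → f (m ℕ.+ k))) ⟨
  sumTo m f + sumTo (suc n) (λ k → f (m ℕ.+ k))                       ∎
  where open ≡-Reasoning

sumTo-periodic : ∀ m n (f : ℕ → ℚ) → (∀ k → f (n ℕ.+ k) ≡ f k) → sumTo (m ℕ.* n) f ≡ ℕ→ℚ m * sumTo n f
sumTo-periodic zero    n f _        = sym (ℚP.*-zeroˡ (sumTo n f))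
sumTo-periodic (suc m) n f periodic = begin
  sumTo (n ℕ.+ m ℕ.* n) f                                   ≡⟨ sumTo-+ n (m ℕ.* n) f ⟩
  sumTo n f + sumTo (m ℕ.* n) (λ k → f (n ℕ.+ k))
    ≡⟨ cong (ℚ._+_ (sumTo n f)) (sumTo-cong (m ℕ.* n) periodic) ⟩
  sumTo n f + sumTo (m ℕ.* n) f
    ≡⟨ cong (ℚ._+_ (sumTo n f)) (sumTo-periodic m n f periodic) ⟩
  sumTo n f + ℕ→ℚ m * sumTo n f
    ≡⟨ solve 2 (λ s m → s :+ m :* s := (con 1ℚ :+ m) :* s) refl (sumTo n f) (ℕ→ℚ m) ⟩
  (1ℚ + ℕ→ℚ m) * sumTo n f                                  ≡⟨ cong (_* sumTo n f) (ℕ→ℚ-homo-+ 1 m) ⟨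
  ℕ→ℚ (suc m) * sumTo n f                                   ∎
  where
  open ≡-Reasoning
  open +-*-Solver

sumTo-multiples-at-≤ : ∀ {p} .{{_ : ℕ.NonZero p}} B {m} (F : ℕ → ℚ) → 1 ℕ.≤ m → (∀ k → 0ℚ ≤ F k) →
                          sumTo B (λ j → ind (p ℕ.* j ℕ.≟ m) (F (p ℕ.* j))) ≤ ind (p ∣? m) (F m)
sumTo-multiples-at-≤ {p} B {m} F 1≤m 0≤F with p ∣? m
... | no p∤m = ℚP.≤-reflexive (sumTo-zero B λ j →
        ind-false (p ℕ.* j ℕ.≟ m) (λ pj≡m → p∤m (divides j (trans (sym pj≡m) (ℕP.*-comm p j)))))
... | yes (divides q m≡qp) = begin
  sumTo B (λ j → ind (p ℕ.* j ℕ.≟ m) (F (p ℕ.* j))) ≡⟨ sumTo-cong B only-q ⟩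
  sumTo B (λ j → ind (q ℕ.≟ j) (F m))               ≡⟨ sumTo-point B (F m) 1≤q ⟩
  ind (q ℕ.≤? B) (F m)                              ≤⟨ ind-≤ (q ℕ.≤? B) (0≤F m) ⟩
  F m                                               ∎
  where
  open ℚP.≤-Reasoning
  pq≡m : p ℕ.* q ≡ m
  pq≡m = trans (ℕP.*-comm p q) (sym m≡qp)
  1≤q : 1 ℕ.≤ q
  1≤q = ℕP.n≢0⇒n>0 λ { refl → contradiction (subst (1 ℕ.≤_) m≡qp 1≤m) λ () }
  only-q : ∀ j → ind (p ℕ.* j ℕ.≟ m) (F (p ℕ.* j)) ≡ ind (q ℕ.≟ j) (F m)
  only-q j with q ℕ.≟ j
  ... | yes refl = trans (ind-true (p ℕ.* q ℕ.≟ m) pq≡m) (cong F pq≡m)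
  ... | no q≢j   = ind-false (p ℕ.* j ℕ.≟ m) (λ pj≡m → q≢j (ℕP.*-cancelˡ-≡ q j p (trans pq≡m (sym pj≡m))))

sumTo-multiples-≤ : ∀ {p} .{{_ : ℕ.NonZero p}} B N (F : ℕ → ℚ) → (∀ k → 0ℚ ≤ F k) →
                    sumTo B (λ j → ind (p ℕ.* j ℕ.≤? N) (F (p ℕ.* j))) ≤ sumTo N (λ k → ind (p ∣? k) (F k))
sumTo-multiples-≤ {p} B zero F 0≤F =
  ℚP.≤-trans (sumTo-mono-≤ B vanish) (ℚP.≤-reflexive (sumTo-zero B (λ _ → refl)))
  where
  vanish : ∀ {j} → 1 ℕ.≤ j → j ℕ.≤ B → ind (p ℕ.* j ℕ.≤? 0) (F (p ℕ.* j)) ≤ 0ℚ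
  vanish {j} 1≤j _ = ℚP.≤-reflexive (ind-false (p ℕ.* j ℕ.≤? 0)
    (λ pj≤0 → contradiction (ℕP.≤-trans (ℕP.*-mono-≤ (ℕ.>-nonZero⁻¹ p) 1≤j) pj≤0) λ ()))
sumTo-multiples-≤ {p} B (suc N) F 0≤F = begin
  sumTo B (λ j → ind (p ℕ.* j ℕ.≤? suc N) (F (p ℕ.* j)))
    ≡⟨ sumTo-cong B (λ j → ind-≤?-suc (p ℕ.* j) N (F (p ℕ.* j))) ⟩
  sumTo B (λ j → ind (p ℕ.* j ℕ.≤? N) (F (p ℕ.* j)) + ind (p ℕ.* j ℕ.≟ suc N) (F (p ℕ.* j)))
    ≡⟨ sumTo-distrib-+ B (λ j → ind (p ℕ.* j ℕ.≤? N) (F (p ℕ.* j))) (λ j → ind (p ℕ.* j ℕ.≟ suc N) (F (p ℕ.* j))) ⟩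
  sumTo B (λ j → ind (p ℕ.* j ℕ.≤? N) (F (p ℕ.* j))) + sumTo B (λ j → ind (p ℕ.* j ℕ.≟ suc N) (F (p ℕ.* j)))
    ≤⟨ ℚP.+-mono-≤ (sumTo-multiples-≤ {p} B N F 0≤F) (sumTo-multiples-at-≤ {p} B F (s≤s z≤n) 0≤F) ⟩
  sumTo N (λ k → ind (p ∣? k) (F k)) + ind (p ∣? suc N) (F (suc N))
    ≡⟨ sumTo-suc N (λ k → ind (p ∣? k) (F k)) ⟨
  sumTo (suc N) (λ k → ind (p ∣? k) (F k)) ∎
  where open ℚP.≤-Reasoning

sumTo-nonMultiples+multiples-≤ : ∀ {p} .{{_ : ℕ.NonZero p}} N (F : ℕ → ℚ) → (∀ k → 0ℚ ≤ F k) →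
  sumTo N (λ ℓ → ind (¬? (p ∣? ℓ)) (F ℓ) + ind (p ℕ.* ℓ ℕ.≤? N) (F (p ℕ.* ℓ))) ≤ sumTo N F
sumTo-nonMultiples+multiples-≤ {p} N F 0≤F = begin
  sumTo N (λ ℓ → ind (¬? (p ∣? ℓ)) (F ℓ) + ind (p ℕ.* ℓ ℕ.≤? N) (F (p ℕ.* ℓ)))
    ≡⟨ sumTo-distrib-+ N (λ ℓ → ind (¬? (p ∣? ℓ)) (F ℓ)) (λ ℓ → ind (p ℕ.* ℓ ℕ.≤? N) (F (p ℕ.* ℓ))) ⟩
  sumTo N (λ ℓ → ind (¬? (p ∣? ℓ)) (F ℓ)) + sumTo N (λ ℓ → ind (p ℕ.* ℓ ℕ.≤? N) (F (p ℕ.* ℓ)))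
    ≤⟨ ℚP.+-monoʳ-≤ (sumTo N (λ ℓ → ind (¬? (p ∣? ℓ)) (F ℓ))) (sumTo-multiples-≤ {p} N N F 0≤F) ⟩
  sumTo N (λ ℓ → ind (¬? (p ∣? ℓ)) (F ℓ)) + sumTo N (λ k → ind (p ∣? k) (F k))
    ≡⟨ sumTo-distrib-+ N (λ ℓ → ind (¬? (p ∣? ℓ)) (F ℓ)) (λ k → ind (p ∣? k) (F k)) ⟨
  sumTo N (λ k → ind (¬? (p ∣? k)) (F k) + ind (p ∣? k) (F k))
    ≡⟨ sumTo-cong N (λ k → ind-complement (p ∣? k) (F k)) ⟩
  sumTo N F ∎
  where open ℚP.≤-Reasoning

prime≥2 : ∀ {p} → Prime p → 2 ℕ.≤ p
prime≥2 {p} pp = ℕ.nonTrivial⇒n>1 p {{prime⇒nonTrivial pp}}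

prime≢1 : ∀ {p} → Prime p → p ≢ 1
prime≢1 pp refl = contradiction (prime≥2 pp) (λ { (s≤s ()) })

m*n≡m⇒n≡1 : ∀ {m n} .{{_ : ℕ.NonZero m}} → m ℕ.* n ≡ m → n ≡ 1
m*n≡m⇒n≡1 {m} {n} mn≡m = ℕP.*-cancelˡ-≡ n 1 m (trans mn≡m (sym (ℕP.*-identityʳ m)))

¬∣⇒coprime : ∀ {p n} → Prime p → ¬ p ∣ n → Coprime n p
¬∣⇒coprime pp p∤n (d∣n , d∣p) with prime⇒irreducible pp d∣p
... | inj₁ d≡1    = d≡1
... | inj₂ refl   = contradiction d∣n p∤n

coprime-* : ∀ {m n o} → Coprime m o → Coprime n o → Coprime (m ℕ.* n) o
coprime-* {m} m⊥o n⊥o {d} (d∣mn , d∣o) = n⊥o (Coprimality.coprime-divisor d⊥m d∣mn , d∣o)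
  where
  d⊥m : Coprime d m
  d⊥m (e∣d , e∣m) = m⊥o (e∣m , ∣-trans e∣d d∣o)

coprime-+-⇔ : ∀ {n k} → Coprime (n ℕ.+ k) n ⇔ Coprime k n
coprime-+-⇔ {n} {k} = mk⇔ drop-n (λ k⊥n → Coprimality.coprime-+ k⊥n)
  where
  drop-n : Coprime (n ℕ.+ k) n → Coprime k n
  drop-n c (d∣k , d∣n) = c (∣m∣n⇒∣m+n d∣n d∣k , d∣n)

coprime-*-prime-⇔ : ∀ {p k ℓ} → Prime p → Coprime k (p ℕ.* ℓ) ⇔ (Coprime k ℓ × ¬ p ∣ k)
coprime-*-prime-⇔ {p} {k} {ℓ} pp = mk⇔ split coprime-product
  where
  coprime-product : Coprime k ℓ × ¬ p ∣ k → Coprime k (p ℕ.* ℓ)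
  coprime-product (k⊥ℓ , p∤k) = Coprimality.sym (coprime-* (Coprimality.sym (¬∣⇒coprime pp p∤k)) (Coprimality.sym k⊥ℓ))
  coprime-factor : Coprime k (p ℕ.* ℓ) → Coprime k ℓ
  coprime-factor c (d∣k , d∣ℓ) = c (d∣k , ∣n⇒∣m*n p d∣ℓ)
  p∤k : Coprime k (p ℕ.* ℓ) → ¬ p ∣ k
  p∤k c p∣k = prime≢1 pp (c (p∣k , m∣m*n ℓ))
  split : Coprime k (p ℕ.* ℓ) → Coprime k ℓ × ¬ p ∣ k
  split c = coprime-factor c , p∤k c

All-range1⁺ : ∀ {P : ℕ → Set} n → (∀ {k} → 1 ℕ.≤ k → k ℕ.≤ n → P k) → All P (range1 n)
All-range1⁺ n P-in-range = AllP.map⁺ (AllP.applyUpTo⁺₁ id n (P-in-range (s≤s z≤n)))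

SquareFree-intro : ∀ {n} → (∀ {m} → 2 ℕ.≤ m → ¬ m ℕ.* m ∣ n) → SquareFree n
SquareFree-intro {n} no-square = all-pass (upTo n)
  where
  all-pass : ∀ ds → T (foldr (λ d b → not (does (suc (suc d) ℕ.* suc (suc d) ∣? n)) ∧ b) true ds)
  all-pass []       = _
  all-pass (d ∷ ds) = Equivalence.from T-∧
    (Equivalence.from T-not-≡ (dec-false (_ ∣? n) (no-square (s≤s (s≤s z≤n)))) , all-pass ds)

SquareFree-elim : ∀ {n m} .{{_ : ℕ.NonZero n}} → SquareFree n → 2 ℕ.≤ m → ¬ m ℕ.* m ∣ n
SquareFree-elim {n} {m@(suc (suc d))} sf (s≤s (s≤s z≤n)) m²∣n =
  each-passes (upTo n) sf (∈-upTo⁺ d<n) m²∣n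
  where
  d<n : d ℕ.< n
  d<n = ℕP.<-≤-trans (ℕP.<-trans (ℕP.n<1+n d) (ℕP.n<1+n (suc d))) (ℕP.≤-trans (ℕP.m≤m*n m m) (∣⇒≤ m²∣n))
  each-passes : ∀ ds → T (foldr (λ d b → not (does (suc (suc d) ℕ.* suc (suc d) ∣? n)) ∧ b) true ds) →
                d ∈ ds → ¬ m ℕ.* m ∣ n
  each-passes (e ∷ es) t (here refl) m²∣n with () ← trans (sym (Equivalence.to T-not-≡ (proj₁ (Equivalence.to T-∧ t))))
                                                           (dec-true (_ ∣? n) m²∣n)
  each-passes (e ∷ es) t (there d∈) = each-passes es (proj₂ (Equivalence.to T-∧ t)) d∈

SquareFree-prime : ∀ {p} → Prime p → SquareFree p
SquareFree-prime {p} pp = SquareFree-intro λ {m} 2≤m m²∣p → case prime⇒irreducible pp (m*n∣⇒m∣ m m m²∣p) of λ where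
  (inj₁ refl) → contradiction 2≤m (λ { (s≤s ()) })
  (inj₂ refl) → ℕP.<-irrefl refl (ℕP.<-≤-trans (ℕP.m<m*n p p {{prime⇒nonZero pp}} (prime≥2 pp))
                                                 (∣⇒≤ {{prime⇒nonZero pp}} m²∣p))

SquareFree-*-prime : ∀ {p ℓ} .{{_ : ℕ.NonZero ℓ}} → Prime p → ¬ p ∣ ℓ → SquareFree ℓ → SquareFree (p ℕ.* ℓ)
SquareFree-*-prime {p} {ℓ} pp p∤ℓ sfℓ = SquareFree-intro no-square
  where
  p∣m²⇒p∣m : ∀ {m} → p ∣ m ℕ.* m → p ∣ m
  p∣m²⇒p∣m {m} p∣m² with euclidsLemma m m pp p∣m²
  ... | inj₁ p∣m = p∣m
  ... | inj₂ p∣m = p∣m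
  no-square : ∀ {m} → 2 ℕ.≤ m → ¬ m ℕ.* m ∣ p ℕ.* ℓ
  no-square {m} 2≤m m²∣pℓ with p ∣? m
  ... | yes p∣m = p∤ℓ (*-cancelˡ-∣ p {{prime⇒nonZero pp}} (∣-trans (*-pres-∣ p∣m p∣m) m²∣pℓ))
  ... | no p∤m  = SquareFree-elim sfℓ 2≤m (Coprimality.coprime-divisor (¬∣⇒coprime pp (p∤m ∘ p∣m²⇒p∣m)) m²∣pℓ)

-- The arithmetic functions μ, φ and φ₂

primeDivisors-prime : ∀ {p} → Prime p → primeDivisors p ≡ p ∷ []
primeDivisors-prime {p@(suc q)} pp = begin
  filter P? (range1 (suc q))                     ≡⟨ cong (filter P?) (range1-suc q) ⟩
  filter P? (range1 q ++ p ∷ [])                 ≡⟨ LP.filter-++ P? (range1 q) (p ∷ []) ⟩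
  filter P? (range1 q) ++ filter P? (p ∷ [])
    ≡⟨ cong₂ _++_ (LP.filter-none P? (All-range1⁺ q smaller-not-prime-divisor)) (LP.filter-accept P? (pp , ∣-refl)) ⟩
  p ∷ []                                         ∎
  where
  open ≡-Reasoning
  P? = λ k → prime? k ×-dec (k ∣? p)
  smaller-not-prime-divisor : ∀ {k} → 1 ℕ.≤ k → k ℕ.≤ q → ¬ (Prime k × k ∣ p)
  smaller-not-prime-divisor 1≤k k≤q (pk , k∣p) with prime⇒irreducible pp k∣p
  ... | inj₁ refl = prime≢1 pk refl
  ... | inj₂ refl = ℕP.<-irrefl refl (s≤s k≤q)

μ-prime : ∀ {p} → Prime p → μ p ≡ -[1+ 0 ]
μ-prime {p} pp rewrite primeDivisors-prime pp | Equivalence.to T-≡ (SquareFree-prime pp) = refl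

φ₂-prime : ∀ {p} → Prime p → φ₂ p ≡ p ℕ.∸ 2
φ₂-prime {p} pp rewrite primeDivisors-prime pp = ℕP.*-identityʳ (p ℕ.∸ 2)

φ-prime : ∀ {p} → Prime p → φ p ≡ p ℕ.∸ 1
φ-prime {p@(suc q)} pp = begin
  length (filter P? (range1 (suc q)))                         ≡⟨ cong (length ∘ filter P?) (range1-suc q) ⟩
  length (filter P? (range1 q ++ p ∷ []))                     ≡⟨ cong length (LP.filter-++ P? (range1 q) (p ∷ [])) ⟩
  length (filter P? (range1 q) ++ filter P? (p ∷ []))         ≡⟨ LP.length-++ (filter P? (range1 q)) ⟩
  length (filter P? (range1 q)) ℕ.+ length (filter P? (p ∷ []))
    ≡⟨ cong₂ (λ xs ys → length xs ℕ.+ length ys) (LP.filter-all P? (All-range1⁺ q smaller-coprime))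
                                                 (LP.filter-reject P? (prime≢1 pp ∘ self-coprime)) ⟩
  length (range1 q) ℕ.+ 0                                     ≡⟨ ℕP.+-identityʳ _ ⟩
  length (range1 q)                                           ≡⟨ LP.length-map suc (upTo q) ⟩
  length (upTo q)                                             ≡⟨ LP.length-upTo q ⟩
  q                                                           ∎
  where
  open ≡-Reasoning
  P? = λ k → coprime? k p
  smaller-coprime : ∀ {k} → 1 ℕ.≤ k → k ℕ.≤ q → Coprime k p
  smaller-coprime {k} 1≤k k≤q = Coprimality.sym (Coprimality.prime⇒coprime pp {{ℕ.>-nonZero 1≤k}} (s≤s k≤q))
  self-coprime : Coprime p p → p ≡ 1
  self-coprime p⊥p = p⊥p (∣-refl , ∣-refl)

negOnePow-square : ∀ k → negOnePow k ℤ.* negOnePow k ≡ + 1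
negOnePow-square zero    = refl
negOnePow-square (suc k) = begin
  ℤ.- a ℤ.* ℤ.- a     ≡⟨ ℤP.neg-distribˡ-* a (ℤ.- a) ⟨
  ℤ.- (a ℤ.* ℤ.- a)   ≡⟨ cong ℤ.-_ (ℤP.neg-distribʳ-* a a) ⟨
  ℤ.- ℤ.- (a ℤ.* a)   ≡⟨ ℤP.neg-involutive (a ℤ.* a) ⟩
  a ℤ.* a             ≡⟨ negOnePow-square k ⟩
  + 1                 ∎
  where
  open ≡-Reasoning
  a = negOnePow k

μ²/φ-squarefree : ∀ {n} → SquareFree n → μ²/φ n ≡ 1ℚ ÷′ ℕ→ℚ (φ n)
μ²/φ-squarefree {n} sf = cong (λ m → ℤ→ℚ m ÷′ ℕ→ℚ (φ n)) μ²≡1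
  where
  μ²≡1 : μ n ℤ.* μ n ≡ + 1
  μ²≡1 rewrite Equivalence.to T-≡ sf = negOnePow-square (length (primeDivisors n))

μ²/φ-nonSquarefree : ∀ {n} → ¬ SquareFree n → μ²/φ n ≡ 0ℚ
μ²/φ-nonSquarefree {n} ¬sf = begin
  ℤ→ℚ (μ n ℤ.* μ n) ÷′ ℕ→ℚ (φ n) ≡⟨ cong (λ m → ℤ→ℚ (m ℤ.* m) ÷′ ℕ→ℚ (φ n)) μ≡0 ⟩
  0ℚ ÷′ ℕ→ℚ (φ n)                 ≡⟨ ÷′≡*1÷′ 0ℚ (ℕ→ℚ (φ n)) ⟩
  0ℚ * (1ℚ ÷′ ℕ→ℚ (φ n))          ≡⟨ ℚP.*-zeroˡ (1ℚ ÷′ ℕ→ℚ (φ n)) ⟩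
  0ℚ                              ∎
  where
  open ≡-Reasoning
  μ≡0 : μ n ≡ + 0
  μ≡0 rewrite ¬-not (¬sf ∘ Equivalence.from T-≡) = refl

μ²/φ-nonNeg : ∀ n → 0ℚ ≤ μ²/φ n
μ²/φ-nonNeg n = by-cases (squarefree? n)
  where
  by-cases : Dec (SquareFree n) → 0ℚ ≤ μ²/φ n
  by-cases (yes sf) = subst (0ℚ ≤_) (sym (μ²/φ-squarefree {n} sf)) (1÷′-nonNeg {ℕ→ℚ (φ n)} (ℕ→ℚ-nonNeg (φ n)))
  by-cases (no ¬sf) = ℚP.≤-reflexive (sym (μ²/φ-nonSquarefree {n} ¬sf))

φ-pos : ∀ {n} → 1 ℕ.≤ n → 1 ℕ.≤ φ n
φ-pos {suc m} _ = LP.filter-some (λ k → coprime? k (suc m)) (here (Coprimality.1-coprimeTo (suc m)))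

ℕ→ℚ-length-filter : ∀ {P : ℕ → Set} (P? : ∀ k → Dec (P k)) xs →
                    ℕ→ℚ (length (filter P? xs)) ≡ foldr (λ k acc → ind (P? k) 1ℚ + acc) 0ℚ xs
ℕ→ℚ-length-filter P? []       = refl
ℕ→ℚ-length-filter P? (x ∷ xs) with P? x
... | yes _ = trans (ℕ→ℚ-homo-+ 1 (length (filter P? xs))) (cong (ℚ._+_ 1ℚ) (ℕ→ℚ-length-filter P? xs))
... | no _  = trans (ℕ→ℚ-length-filter P? xs) (sym (ℚP.+-identityˡ (foldr (λ k acc → ind (P? k) 1ℚ + acc) 0ℚ xs)))

[_⊥_] : ℕ → ℕ → ℚ
[ k ⊥ n ] = ind (coprime? k n) 1ℚ

φ-as-sumTo : ∀ n → ℕ→ℚ (φ n) ≡ sumTo n (λ k → [ k ⊥ n ])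
φ-as-sumTo n = ℕ→ℚ-length-filter (λ k → coprime? k n) (range1 n)

sumTo-coprime-periodic : ∀ m ℓ → sumTo (m ℕ.* ℓ) (λ k → [ k ⊥ ℓ ]) ≡ ℕ→ℚ m * ℕ→ℚ (φ ℓ)
sumTo-coprime-periodic m ℓ = begin
  sumTo (m ℕ.* ℓ) (λ k → [ k ⊥ ℓ ])  ≡⟨ sumTo-periodic m ℓ (λ k → [ k ⊥ ℓ ]) shift ⟩
  ℕ→ℚ m * sumTo ℓ (λ k → [ k ⊥ ℓ ])  ≡⟨ cong (ℕ→ℚ m *_) (φ-as-sumTo ℓ) ⟨
  ℕ→ℚ m * ℕ→ℚ (φ ℓ)                  ∎
  where
  open ≡-Reasoning
  shift : ∀ k → [ ℓ ℕ.+ k ⊥ ℓ ] ≡ [ k ⊥ ℓ ]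
  shift k = ind-cong coprime-+-⇔ (coprime? (ℓ ℕ.+ k) ℓ) (coprime? k ℓ)

[⊥*prime]+[∣][⊥] : ∀ {p} ℓ k → Prime p → [ k ⊥ p ℕ.* ℓ ] + ind (p ∣? k) [ k ⊥ ℓ ] ≡ [ k ⊥ ℓ ]
[⊥*prime]+[∣][⊥] {p} ℓ k pp with coprime? k ℓ | p ∣? k
... | yes _   | yes p∣k = trans (cong (_+ 1ℚ) (ind-false (coprime? k (p ℕ.* ℓ)) (λ c → proj₂ (to c) p∣k)))
                                (ℚP.+-identityˡ 1ℚ)
  where open Equivalence (coprime-*-prime-⇔ pp)
... | yes k⊥ℓ | no p∤k  = trans (ℚP.+-identityʳ [ k ⊥ p ℕ.* ℓ ]) (ind-true (coprime? k (p ℕ.* ℓ)) (from (k⊥ℓ , p∤k)))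
  where open Equivalence (coprime-*-prime-⇔ pp)
... | no ¬k⊥ℓ | yes _   = trans (ℚP.+-identityʳ [ k ⊥ p ℕ.* ℓ ]) (ind-false (coprime? k (p ℕ.* ℓ)) (¬k⊥ℓ ∘ proj₁ ∘ to))
  where open Equivalence (coprime-*-prime-⇔ pp)
... | no ¬k⊥ℓ | no _    = trans (ℚP.+-identityʳ [ k ⊥ p ℕ.* ℓ ]) (ind-false (coprime? k (p ℕ.* ℓ)) (¬k⊥ℓ ∘ proj₁ ∘ to))
  where open Equivalence (coprime-*-prime-⇔ pp)

φ≤sumTo-multiples-coprime : ∀ {p ℓ} → Prime p → ¬ p ∣ ℓ →
                            ℕ→ℚ (φ ℓ) ≤ sumTo (p ℕ.* ℓ) (λ k → ind (p ∣? k) [ k ⊥ ℓ ])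
φ≤sumTo-multiples-coprime {p} {ℓ} pp p∤ℓ = begin
  ℕ→ℚ (φ ℓ)                                                      ≡⟨ φ-as-sumTo ℓ ⟩
  sumTo ℓ (λ j → [ j ⊥ ℓ ])                                      ≤⟨ sumTo-mono-≤ ℓ (λ _ j≤ℓ → ℚP.≤-reflexive (keep-multiple j≤ℓ)) ⟩
  sumTo ℓ (λ j → ind (p ℕ.* j ℕ.≤? p ℕ.* ℓ) [ p ℕ.* j ⊥ ℓ ])
    ≤⟨ sumTo-multiples-≤ {p} {{prime⇒nonZero pp}} ℓ (p ℕ.* ℓ) (λ k → [ k ⊥ ℓ ]) (λ k → ind-nonNeg (coprime? k ℓ) 0≤1) ⟩
  sumTo (p ℕ.* ℓ) (λ k → ind (p ∣? k) [ k ⊥ ℓ ])                 ∎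
  where
  open ℚP.≤-Reasoning
  p⊥ℓ : Coprime p ℓ
  p⊥ℓ = Coprimality.sym (¬∣⇒coprime pp p∤ℓ)
  scale-⇔ : ∀ {j} → Coprime (p ℕ.* j) ℓ ⇔ Coprime j ℓ
  scale-⇔ {j} = mk⇔ drop-p (coprime-* p⊥ℓ)
    where
    drop-p : Coprime (p ℕ.* j) ℓ → Coprime j ℓ
    drop-p c (d∣j , d∣ℓ) = c (∣n⇒∣m*n p d∣j , d∣ℓ)
  keep-multiple : ∀ {j} → j ℕ.≤ ℓ → [ j ⊥ ℓ ] ≡ ind (p ℕ.* j ℕ.≤? p ℕ.* ℓ) [ p ℕ.* j ⊥ ℓ ]
  keep-multiple {j} j≤ℓ = sym (trans (ind-true (p ℕ.* j ℕ.≤? p ℕ.* ℓ) (ℕP.*-monoʳ-≤ p j≤ℓ))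
                                     (ind-cong scale-⇔ (coprime? (p ℕ.* j) ℓ) (coprime? j ℓ)))

-- Among the pφ(ℓ) integers k ≤ pℓ prime to ℓ, those divisible by p include pj for the φ(ℓ)
-- integers j ≤ ℓ prime to ℓ; the others are exactly the k prime to pℓ.
φ-*-prime-≤ : ∀ {p ℓ} → Prime p → ¬ p ∣ ℓ → ℕ→ℚ (φ (p ℕ.* ℓ)) ≤ ℕ→ℚ (p ℕ.∸ 1) * ℕ→ℚ (φ ℓ)
φ-*-prime-≤ {p@(suc q)} {ℓ} pp p∤ℓ = +-cancelˡ-≤ Φ (begin
  Φ + ℕ→ℚ (φ (p ℕ.* ℓ))                                    ≤⟨ ℚP.+-monoˡ-≤ (ℕ→ℚ (φ (p ℕ.* ℓ))) (φ≤sumTo-multiples-coprime pp p∤ℓ) ⟩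
  M + ℕ→ℚ (φ (p ℕ.* ℓ))                                    ≡⟨ ℚP.+-comm M (ℕ→ℚ (φ (p ℕ.* ℓ))) ⟩
  ℕ→ℚ (φ (p ℕ.* ℓ)) + M                                    ≡⟨ cong (_+ M) (φ-as-sumTo (p ℕ.* ℓ)) ⟩
  sumTo (p ℕ.* ℓ) (λ k → [ k ⊥ p ℕ.* ℓ ]) + M
    ≡⟨ sumTo-distrib-+ (p ℕ.* ℓ) (λ k → [ k ⊥ p ℕ.* ℓ ]) (λ k → ind (p ∣? k) [ k ⊥ ℓ ]) ⟨
  sumTo (p ℕ.* ℓ) (λ k → [ k ⊥ p ℕ.* ℓ ] + ind (p ∣? k) [ k ⊥ ℓ ])
    ≡⟨ sumTo-cong (p ℕ.* ℓ) (λ k → [⊥*prime]+[∣][⊥] ℓ k pp) ⟩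
  sumTo (p ℕ.* ℓ) (λ k → [ k ⊥ ℓ ])                        ≡⟨ sumTo-coprime-periodic p ℓ ⟩
  ℕ→ℚ (1 ℕ.+ q) * Φ                                        ≡⟨ cong (_* Φ) (ℕ→ℚ-homo-+ 1 q) ⟩
  (1ℚ + ℕ→ℚ q) * Φ                                         ≡⟨ ℚP.*-distribʳ-+ Φ 1ℚ (ℕ→ℚ q) ⟩
  1ℚ * Φ + ℕ→ℚ q * Φ                                       ≡⟨ cong (_+ ℕ→ℚ q * Φ) (ℚP.*-identityˡ Φ) ⟩
  Φ + ℕ→ℚ q * Φ                                            ∎)
  where
  open ℚP.≤-Reasoning
  Φ = ℕ→ℚ (φ ℓ)
  M = sumTo (p ℕ.* ℓ) (λ k → ind (p ∣? k) [ k ⊥ ℓ ])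

μ²/φ-*-prime : ∀ {p ℓ} → Prime p → 1 ℕ.≤ ℓ → ¬ p ∣ ℓ → μ²/φ ℓ * (1ℚ ÷′ ℕ→ℚ (p ℕ.∸ 1)) ≤ μ²/φ (p ℕ.* ℓ)
μ²/φ-*-prime {p} {ℓ} pp 1≤ℓ p∤ℓ = by-cases (squarefree? ℓ)
  where
  instance _ = ℕ.>-nonZero 1≤ℓ
  u = ℕ→ℚ (p ℕ.∸ 1)
  Φ = ℕ→ℚ (φ ℓ)
  1≤pℓ = ℕP.*-mono-≤ (ℕP.≤-trans (s≤s z≤n) (prime≥2 pp)) 1≤ℓ
  by-cases : Dec (SquareFree ℓ) → μ²/φ ℓ * (1ℚ ÷′ u) ≤ μ²/φ (p ℕ.* ℓ)
  by-cases (no ¬sf) = begin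
    μ²/φ ℓ * (1ℚ ÷′ u) ≡⟨ cong (_* (1ℚ ÷′ u)) (μ²/φ-nonSquarefree {ℓ} ¬sf) ⟩
    0ℚ * (1ℚ ÷′ u)     ≡⟨ ℚP.*-zeroˡ (1ℚ ÷′ u) ⟩
    0ℚ                 ≤⟨ μ²/φ-nonNeg (p ℕ.* ℓ) ⟩
    μ²/φ (p ℕ.* ℓ)     ∎
    where open ℚP.≤-Reasoning
  by-cases (yes sf) = begin
    μ²/φ ℓ * (1ℚ ÷′ u)          ≡⟨ cong (_* (1ℚ ÷′ u)) (μ²/φ-squarefree {ℓ} sf) ⟩
    (1ℚ ÷′ Φ) * (1ℚ ÷′ u)       ≡⟨ 1÷′-distrib-* Φ u ⟨
    1ℚ ÷′ (Φ * u)
      ≤⟨ 1÷′-antimono-≤ {ℕ→ℚ (φ (p ℕ.* ℓ))} {Φ * u} (ℕ→ℚ-pos (φ-pos {p ℕ.* ℓ} 1≤pℓ))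
           (ℚP.≤-trans (φ-*-prime-≤ {p} {ℓ} pp p∤ℓ) (ℚP.≤-reflexive (ℚP.*-comm u Φ))) ⟩
    1ℚ ÷′ ℕ→ℚ (φ (p ℕ.* ℓ))     ≡⟨ μ²/φ-squarefree {p ℕ.* ℓ} (SquareFree-*-prime {p} {ℓ} pp p∤ℓ sf) ⟨
    μ²/φ (p ℕ.* ℓ)              ∎
    where open ℚP.≤-Reasoning

-- ξ at a prime

ξ-weight : ℕ → ℚ
ξ-weight c = (ℤ→ℚ (μ c) * ℕ→ℚ (φ₂ c)) ÷′ ℕ→ℚ (φ c)

-- The summand of ξ in Defs, so that ξ q y is by definition the sum of ξ-term q y over [1, q]³.
ξ-term : ℕ → ℚ → ℕ → ℕ → ℕ → ℚ
ξ-term q y a b c =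
  ind (a ℕ.* b ℕ.* c ℕ.≟ q) (ind (ℕ→ℚ (a ℕ.* c) ℚP.≤? y) (ind (ℕ→ℚ (b ℕ.* c) ℚP.≤? y) (ξ-weight c)))

ξ-weight-prime : ∀ {p} → Prime p → ξ-weight p ≡ - ℕ→ℚ (p ℕ.∸ 2) * (1ℚ ÷′ ℕ→ℚ (p ℕ.∸ 1))
ξ-weight-prime {p} pp = begin
  (ℤ→ℚ (μ p) * ℕ→ℚ (φ₂ p)) ÷′ ℕ→ℚ (φ p) ≡⟨ cong₂ (λ m f₂ → (ℤ→ℚ m * ℕ→ℚ f₂) ÷′ ℕ→ℚ (φ p)) (μ-prime pp) (φ₂-prime pp) ⟩
  (- 1ℚ * v) ÷′ ℕ→ℚ (φ p)               ≡⟨ cong (λ f → (- 1ℚ * v) ÷′ ℕ→ℚ f) (φ-prime pp) ⟩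
  (- 1ℚ * v) ÷′ u                       ≡⟨ ÷′≡*1÷′ (- 1ℚ * v) u ⟩
  (- 1ℚ * v) * (1ℚ ÷′ u)
    ≡⟨ cong (_* (1ℚ ÷′ u)) (trans (sym (ℚP.neg-distribˡ-* 1ℚ v)) (cong -_ (ℚP.*-identityˡ v))) ⟩
  - v * (1ℚ ÷′ u)                       ∎
  where
  open ≡-Reasoning
  u = ℕ→ℚ (p ℕ.∸ 1)
  v = ℕ→ℚ (p ℕ.∸ 2)

ξ-weights-prime : ∀ {p} → Prime p → ξ-weight p + ξ-weight 1 + ξ-weight 1 ≡ 1ℚ + 1ℚ ÷′ ℕ→ℚ (p ℕ.∸ 1)
ξ-weights-prime {p} pp = begin
  ξ-weight p + ξ-weight 1 + ξ-weight 1 ≡⟨⟩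
  ξ-weight p + 1ℚ + 1ℚ               ≡⟨ cong (λ x → x + 1ℚ + 1ℚ) (ξ-weight-prime pp) ⟩
  - v * i + 1ℚ + 1ℚ                  ≡⟨ solve 2 (λ v i → (:- v) :* i :+ con 1ℚ :+ con 1ℚ
                                                     := con 1ℚ :+ i :+ (con 1ℚ :- (con 1ℚ :+ v) :* i)) refl v i ⟩
  1ℚ + i + (1ℚ - (1ℚ + v) * i)       ≡⟨ cong (λ x → 1ℚ + i + (1ℚ - x * i)) u≡1+v ⟨
  1ℚ + i + (1ℚ - u * i)              ≡⟨ cong (λ x → 1ℚ + i + (1ℚ - x)) (*-1÷′-inverseʳ u≢0) ⟩
  1ℚ + i + 0ℚ                        ≡⟨ ℚP.+-identityʳ (1ℚ + i) ⟩
  1ℚ + i                             ∎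
  where
  open ≡-Reasoning
  open +-*-Solver
  u = ℕ→ℚ (p ℕ.∸ 1)
  v = ℕ→ℚ (p ℕ.∸ 2)
  i = 1ℚ ÷′ u
  u≡1+v : u ≡ 1ℚ + v
  u≡1+v = trans (cong ℕ→ℚ (ℕP.+-∸-assoc 1 (prime≥2 pp))) (ℕ→ℚ-homo-+ 1 (p ℕ.∸ 2))
  u≢0 : u ≢ 0ℚ
  u≢0 = ℚP.<⇒≢ (ℕ→ℚ-pos (ℕP.∸-monoˡ-≤ 1 (prime≥2 pp))) ∘ sym

module _ {p : ℕ} (pp : Prime p) (y : ℚ) where
  private
    instance _ = prime⇒nonZero pp
    t = ξ-term p y
    1<p = prime≥2 pp
    1≤p = ℕP.<⇒≤ 1<p

    off : ∀ a b c → a ℕ.* b ℕ.* c ≢ p → t a b c ≡ 0ℚ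
    off a b c = ind-false (a ℕ.* b ℕ.* c ℕ.≟ p)

    non-divisor : ∀ {a m} → a ∣ m → m ≡ p → a ≢ 1 → a ≢ p → ⊥
    non-divisor a∣m refl a≢1 a≢p with prime⇒irreducible pp a∣m
    ... | inj₁ a≡1 = a≢1 a≡1
    ... | inj₂ a≡p = a≢p a≡p

    near : ℕ→ℚ p ≤ y → ∀ a b c → a ℕ.* b ℕ.* c ≡ p → t a b c ≡ ξ-weight c
    near p≤y a b c abc≡p = begin
      t a b c
        ≡⟨ ind-true (a ℕ.* b ℕ.* c ℕ.≟ p) abc≡p ⟩
      ind (ℕ→ℚ (a ℕ.* c) ℚP.≤? y) (ind (ℕ→ℚ (b ℕ.* c) ℚP.≤? y) (ξ-weight c))
        ≡⟨ ind-true (ℕ→ℚ (a ℕ.* c) ℚP.≤? y) (below ac∣p) ⟩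
      ind (ℕ→ℚ (b ℕ.* c) ℚP.≤? y) (ξ-weight c)
        ≡⟨ ind-true (ℕ→ℚ (b ℕ.* c) ℚP.≤? y) (below bc∣p) ⟩
      ξ-weight c                                                                ∎
      where
      open ≡-Reasoning
      open ℕ-Solver
      below : ∀ {m} → m ∣ p → ℕ→ℚ m ≤ y
      below m∣p = ℚP.≤-trans (ℕ→ℚ-mono-≤ (∣⇒≤ m∣p)) p≤y
      ac∣p = subst (a ℕ.* c ∣_) abc≡p (divides b (solve 3 (λ a b c → a :* b :* c := b :* (a :* c)) refl a b c))
      bc∣p = subst (b ℕ.* c ∣_) abc≡p (divides a (ℕP.*-assoc a b c))

    far-ac : ¬ ℕ→ℚ p ≤ y → ∀ a b c → a ℕ.* c ≡ p → t a b c ≡ 0ℚ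
    far-ac p≰y a b c ac≡p = trans
      (cong (ind (a ℕ.* b ℕ.* c ℕ.≟ p)) (ind-false (ℕ→ℚ (a ℕ.* c) ℚP.≤? y) (p≰y ∘ subst (λ m → ℕ→ℚ m ≤ y) ac≡p)))
      (ind-zero (a ℕ.* b ℕ.* c ℕ.≟ p))

    far-bc : ¬ ℕ→ℚ p ≤ y → ∀ a b c → b ℕ.* c ≡ p → t a b c ≡ 0ℚ
    far-bc p≰y a b c bc≡p = trans
      (cong (ind (a ℕ.* b ℕ.* c ℕ.≟ p)) (trans
        (cong (ind (ℕ→ℚ (a ℕ.* c) ℚP.≤? y)) (ind-false (ℕ→ℚ (b ℕ.* c) ℚP.≤? y) (p≰y ∘ subst (λ m → ℕ→ℚ m ≤ y) bc≡p)))
        (ind-zero (ℕ→ℚ (a ℕ.* c) ℚP.≤? y))))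
      (ind-zero (a ℕ.* b ℕ.* c ℕ.≟ p))

  ξ-three-terms : ξ p y ≡ t 1 1 p + t 1 p 1 + t p 1 1
  ξ-three-terms = begin
    sumTo p (λ a → sumTo p (λ b → sumTo p (t a b)))
      ≡⟨ sumTo-pair (λ a → sumTo p (λ b → sumTo p (t a b))) ℕP.≤-refl 1<p
           (λ a a≢1 a≢p → sumTo-zero p λ b → sumTo-zero p λ c →
              off a b c (λ abc≡p → non-divisor (∣m⇒∣m*n c (m∣m*n b)) abc≡p a≢1 a≢p)) ⟩
    sumTo p (λ b → sumTo p (t 1 b)) + sumTo p (λ b → sumTo p (t p b))
      ≡⟨ cong₂ _+_
           (sumTo-pair (λ b → sumTo p (t 1 b)) ℕP.≤-refl 1<p
              (λ b b≢1 b≢p → sumTo-zero p λ c → off 1 b c (λ 1bc≡p → non-divisor (∣m⇒∣m*n c (n∣m*n 1)) 1bc≡p b≢1 b≢p)))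
           (sumTo-single p (λ b → sumTo p (t p b)) ℕP.≤-refl 1≤p
              (λ b b≢1 → sumTo-zero p λ c → off p b c (λ pbc≡p →
                 b≢1 (ℕP.m*n≡1⇒m≡1 b c (m*n≡m⇒n≡1 (trans (sym (ℕP.*-assoc p b c)) pbc≡p)))))) ⟩
    sumTo p (t 1 1) + sumTo p (t 1 p) + sumTo p (t p 1)
      ≡⟨ cong₂ _+_ (cong₂ _+_
           (sumTo-single p (t 1 1) 1≤p ℕP.≤-refl (λ c c≢p → off 1 1 c (λ 11c≡p → c≢p (trans (sym (ℕP.*-identityˡ c)) 11c≡p))))
           (sumTo-single p (t 1 p) ℕP.≤-refl 1≤p (λ c c≢1 → off 1 p c (λ 1pc≡p →
              c≢1 (m*n≡m⇒n≡1 (trans (cong (ℕ._* c) (sym (ℕP.*-identityˡ p))) 1pc≡p))))))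
           (sumTo-single p (t p 1) ℕP.≤-refl 1≤p (λ c c≢1 → off p 1 c (λ p1c≡p →
              c≢1 (m*n≡m⇒n≡1 (trans (cong (ℕ._* c) (sym (ℕP.*-identityʳ p))) p1c≡p))))) ⟩
    t 1 1 p + t 1 p 1 + t p 1 1 ∎
    where open ≡-Reasoning

  ξ-prime : ξ p y ≡ ind (ℕ→ℚ p ℚP.≤? y) (1ℚ + 1ℚ ÷′ ℕ→ℚ (p ℕ.∸ 1))
  ξ-prime = trans ξ-three-terms (by-size (ℕ→ℚ p ℚP.≤? y))
    where
    by-size : (p≤y? : Dec (ℕ→ℚ p ≤ y)) → t 1 1 p + t 1 p 1 + t p 1 1 ≡ ind p≤y? (1ℚ + 1ℚ ÷′ ℕ→ℚ (p ℕ.∸ 1))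
    by-size (yes p≤y) = trans
      (cong₂ _+_ (cong₂ _+_ (near p≤y 1 1 p (ℕP.*-identityˡ p))
                            (near p≤y 1 p 1 (trans (ℕP.*-identityʳ (1 ℕ.* p)) (ℕP.*-identityˡ p))))
                 (near p≤y p 1 1 (trans (ℕP.*-identityʳ (p ℕ.* 1)) (ℕP.*-identityʳ p))))
      (ξ-weights-prime pp)
    by-size (no p≰y) = cong₂ _+_ (cong₂ _+_ (far-ac p≰y 1 1 p (ℕP.*-identityˡ p)) (far-bc p≰y 1 p 1 (ℕP.*-identityʳ p)))
                                 (far-ac p≰y p 1 1 (ℕP.*-identityʳ p))

  ξ-prime-nonNeg : 0ℚ ≤ ξ p y
  ξ-prime-nonNeg = subst (0ℚ ≤_) (sym ξ-prime) (ind-nonNeg (ℕ→ℚ p ℚP.≤? y)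
    (ℚP.≤-trans 0≤1 (ℚP.≤-trans (ℚP.≤-reflexive (sym (ℚP.+-identityʳ 1ℚ)))
                                (ℚP.+-monoʳ-≤ 1ℚ (1÷′-nonNeg (ℕ→ℚ-nonNeg (p ℕ.∸ 1)))))))

-- G_[p] ≤ G_τ

module _ (z₀ z : ℚ) (τ : ℕ) {p : ℕ} (pp : Prime p) (p⊥Q : Coprime p (τ ℕ.* P z₀)) where
  private
    instance _ = prime⇒nonZero pp
    N = ℤ.∣ ℚ.floor z ∣
    Q = τ ℕ.* P z₀

    Gτ-term : ℕ → ℚ
    Gτ-term m = ind (ℕ→ℚ m ℚP.≤? z) (ind (coprime? m Q) (μ²/φ m))

    ℓ√p≤z? : ∀ ℓ → Dec ((0ℚ ≤ z) × (ℕ→ℚ (ℓ ℕ.* ℓ ℕ.* p) ≤ z * z))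
    ℓ√p≤z? ℓ = (0ℚ ℚP.≤? z) ×-dec (ℕ→ℚ (ℓ ℕ.* ℓ ℕ.* p) ℚP.≤? z * z)

    summand : ℕ → ℚ
    summand ℓ = μ²/φ ℓ * ξ p (z ÷′ ℕ→ℚ ℓ)

    G[p]-term : ℕ → ℚ
    G[p]-term ℓ = ind (ℓ√p≤z? ℓ) (ind (coprime? ℓ (p ℕ.* τ ℕ.* P z₀)) (summand ℓ))

    paired : ℕ → ℚ
    paired ℓ = ind (¬? (p ∣? ℓ)) (Gτ-term ℓ) + ind (p ℕ.* ℓ ℕ.≤? N) (Gτ-term (p ℕ.* ℓ))

    Gτ-term-nonNeg : ∀ m → 0ℚ ≤ Gτ-term m
    Gτ-term-nonNeg m = ind-nonNeg (ℕ→ℚ m ℚP.≤? z) (ind-nonNeg (coprime? m Q) (μ²/φ-nonNeg m))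

    summand-nonNeg : ∀ ℓ → 0ℚ ≤ summand ℓ
    summand-nonNeg ℓ = *-nonNeg (μ²/φ-nonNeg ℓ) (ξ-prime-nonNeg pp (z ÷′ ℕ→ℚ ℓ))

    paired-nonNeg : ∀ ℓ → 0ℚ ≤ paired ℓ
    paired-nonNeg ℓ = ℚP.+-mono-≤ (ind-nonNeg (¬? (p ∣? ℓ)) (Gτ-term-nonNeg ℓ))
                                  (ind-nonNeg (p ℕ.* ℓ ℕ.≤? N) (Gτ-term-nonNeg (p ℕ.* ℓ)))

    summand≤paired : ∀ {ℓ} → 1 ℕ.≤ ℓ → Coprime ℓ (p ℕ.* τ ℕ.* P z₀) → summand ℓ ≤ paired ℓ
    summand≤paired {ℓ} 1≤ℓ ℓ⊥pQ =
      subst (_≤ paired ℓ) (cong (μ²/φ ℓ *_) (sym (ξ-prime pp (z ÷′ L)))) (by-size (ℕ→ℚ p ℚP.≤? z ÷′ L))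
      where
      L = ℕ→ℚ ℓ
      i = 1ℚ ÷′ ℕ→ℚ (p ℕ.∸ 1)
      p∤ℓ : ¬ p ∣ ℓ
      p∤ℓ p∣ℓ = prime≢1 pp (ℓ⊥pQ (p∣ℓ , ∣m⇒∣m*n (P z₀) (m∣m*n τ)))
      ℓ⊥Q : Coprime ℓ Q
      ℓ⊥Q {d} (d∣ℓ , d∣Q) = ℓ⊥pQ (d∣ℓ , subst (d ∣_) (sym (ℕP.*-assoc p τ (P z₀))) (∣n⇒∣m*n p d∣Q))
      by-size : (d : Dec (ℕ→ℚ p ≤ z ÷′ L)) → μ²/φ ℓ * ind d (1ℚ + i) ≤ paired ℓ
      by-size (no _) = ℚP.≤-trans (ℚP.≤-reflexive (ℚP.*-zeroʳ (μ²/φ ℓ))) (paired-nonNeg ℓ)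
      by-size (yes p≤z/ℓ) = begin
        μ²/φ ℓ * (1ℚ + i)                      ≡⟨ ℚP.*-distribˡ-+ (μ²/φ ℓ) 1ℚ i ⟩
        μ²/φ ℓ * 1ℚ + μ²/φ ℓ * i               ≡⟨ cong (_+ μ²/φ ℓ * i) (ℚP.*-identityʳ (μ²/φ ℓ)) ⟩
        μ²/φ ℓ + μ²/φ ℓ * i                    ≤⟨ ℚP.+-monoʳ-≤ (μ²/φ ℓ) (μ²/φ-*-prime pp 1≤ℓ p∤ℓ) ⟩
        μ²/φ ℓ + μ²/φ (p ℕ.* ℓ)                ≡⟨ cong₂ _+_ Gτ-term-ℓ Gτ-term-pℓ ⟨
        Gτ-term ℓ + Gτ-term (p ℕ.* ℓ)
          ≡⟨ cong₂ _+_ (ind-true (¬? (p ∣? ℓ)) p∤ℓ) (ind-true (p ℕ.* ℓ ℕ.≤? N) pℓ≤N) ⟨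
        paired ℓ                               ∎
        where
        open ℚP.≤-Reasoning
        pℓ≤z : ℕ→ℚ (p ℕ.* ℓ) ≤ z
        pℓ≤z = begin
          ℕ→ℚ (p ℕ.* ℓ)   ≡⟨ ℕ→ℚ-homo-* p ℓ ⟩
          ℕ→ℚ p * L       ≤⟨ ℚP.*-monoʳ-≤-nonNeg L {{ℚ.nonNegative (ℕ→ℚ-nonNeg ℓ)}} p≤z/ℓ ⟩
          (z ÷′ L) * L    ≡⟨ ÷′-*-cancel z (ℚP.<⇒≢ (ℕ→ℚ-pos 1≤ℓ) ∘ sym) ⟩
          z               ∎
        pℓ≤N = ≤⇒≤∣floor∣ (p ℕ.* ℓ) z pℓ≤z
        Gτ-term-ℓ : Gτ-term ℓ ≡ μ²/φ ℓ
        Gτ-term-ℓ = trans (ind-true (ℕ→ℚ ℓ ℚP.≤? z) (ℚP.≤-trans (ℕ→ℚ-mono-≤ (ℕP.m≤n*m ℓ p)) pℓ≤z))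
                          (ind-true (coprime? ℓ Q) ℓ⊥Q)
        Gτ-term-pℓ : Gτ-term (p ℕ.* ℓ) ≡ μ²/φ (p ℕ.* ℓ)
        Gτ-term-pℓ = trans (ind-true (ℕ→ℚ (p ℕ.* ℓ) ℚP.≤? z) pℓ≤z)
                           (ind-true (coprime? (p ℕ.* ℓ) Q) (coprime-* p⊥Q ℓ⊥Q))

    -- The constraint ℓ ≤ z/√p is dropped: ξ_p(z/ℓ) already vanishes unless pℓ ≤ z.
    G[p]-term≤paired : ∀ {ℓ} → 1 ℕ.≤ ℓ → G[p]-term ℓ ≤ paired ℓ
    G[p]-term≤paired {ℓ} 1≤ℓ =
      ℚP.≤-trans (ind-≤ (ℓ√p≤z? ℓ) (ind-nonNeg ℓ⊥pQ? (summand-nonNeg ℓ))) (by-coprimality ℓ⊥pQ?)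
      where
      ℓ⊥pQ? = coprime? ℓ (p ℕ.* τ ℕ.* P z₀)
      by-coprimality : (c? : Dec (Coprime ℓ (p ℕ.* τ ℕ.* P z₀))) → ind c? (summand ℓ) ≤ paired ℓ
      by-coprimality (no _)      = paired-nonNeg ℓ
      by-coprimality (yes ℓ⊥pQ) = summand≤paired 1≤ℓ ℓ⊥pQ

  G[p]≤G : G[ p ] z z₀ τ ≤ G τ z z₀
  G[p]≤G = begin
    sumTo N G[p]-term  ≤⟨ sumTo-mono-≤ N {G[p]-term} {paired} (λ 1≤ℓ _ → G[p]-term≤paired 1≤ℓ) ⟩
    sumTo N paired     ≤⟨ sumTo-nonMultiples+multiples-≤ {p} N Gτ-term Gτ-term-nonNeg ⟩
    sumTo N Gτ-term    ∎
    where open ℚP.≤-Reasoning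

  0≤G[p] : 0ℚ ≤ G[ p ] z z₀ τ
  0≤G[p] = sumTo-nonNeg N (λ {ℓ} _ _ → ind-nonNeg (ℓ√p≤z? ℓ) (ind-nonNeg (coprime? ℓ (p ℕ.* τ ℕ.* P z₀)) (summand-nonNeg ℓ)))

-- Also true for g = 0: both sides are then 0, as ÷′ returns 0 on a zero denominator.
normalized-weight : ∀ {u} g a → u ≢ 0ℚ → ((- 1ℚ) ÷′ (u * g)) * (a ÷′ g) * g * u ≡ - (a ÷′ g)
normalized-weight {u} g a u≢0 with 0ℚ ℚP.≟ g
... | yes refl = trans (cong (_* u) (ℚP.*-zeroʳ (((- 1ℚ) ÷′ (u * 0ℚ)) * (a ÷′ 0ℚ)))) (ℚP.*-zeroˡ u)
... | no 0≢g = begin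
  ((- 1ℚ) ÷′ (u * g)) * (a ÷′ g) * g * u
    ≡⟨ cong₂ (λ x y → x * y * g * u) (trans (÷′≡*1÷′ (- 1ℚ) (u * g)) (cong (- 1ℚ *_) (1÷′-distrib-* u g))) (÷′≡*1÷′ a g) ⟩
  - 1ℚ * (1/u * 1/g) * (a * 1/g) * g * u
    ≡⟨ solve 5 (λ a g u i j → con (- 1ℚ) :* (i :* j) :* (a :* j) :* g :* u := :- (a :* j) :* (u :* i :* (g :* j)))
             refl a g u 1/u 1/g ⟩
  - (a * 1/g) * (u * 1/u * (g * 1/g))
    ≡⟨ cong (λ x → - (a * 1/g) * x) (cong₂ _*_ (*-1÷′-inverseʳ u≢0) (*-1÷′-inverseʳ (0≢g ∘ sym))) ⟩
  - (a * 1/g) * 1ℚ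
    ≡⟨ ℚP.*-identityʳ (- (a * 1/g)) ⟩
  - (a * 1/g)
    ≡⟨ cong -_ (÷′≡*1÷′ a g) ⟨
  - (a ÷′ g) ∎
  where
  open ≡-Reasoning
  open +-*-Solver
  1/u = 1ℚ ÷′ u
  1/g = 1ℚ ÷′ g

w-nonCoprime : ∀ {p} z₀ z τ → ¬ Coprime p (τ ℕ.* P z₀) → w p z z₀ τ ≡ 0ℚ
w-nonCoprime {p} z₀ z τ ¬p⊥Q = ind-false (squarefree? p ×-dec coprime? p (τ ℕ.* P z₀)) (¬p⊥Q ∘ proj₂)

w*G*[p∸1]≡-G[p]÷′G : ∀ {p} z₀ z τ → Prime p → Coprime p (τ ℕ.* P z₀) →
                     w p z z₀ τ * G τ z z₀ * ℕ→ℚ (p ℕ.∸ 1) ≡ - (G[ p ] z z₀ τ ÷′ G τ z z₀)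
w*G*[p∸1]≡-G[p]÷′G {p} z₀ z τ pp p⊥Q = begin
  w p z z₀ τ * Gτ * u
    ≡⟨ cong (λ x → x * Gτ * u) (ind-true (squarefree? p ×-dec coprime? p (τ ℕ.* P z₀)) (SquareFree-prime pp , p⊥Q)) ⟩
  (ℤ→ℚ (μ p) ÷′ (ℕ→ℚ (φ p) * Gτ)) * (Gp ÷′ Gτ) * Gτ * u
    ≡⟨ cong₂ (λ m f → (ℤ→ℚ m ÷′ (ℕ→ℚ f * Gτ)) * (Gp ÷′ Gτ) * Gτ * u) (μ-prime pp) (φ-prime pp) ⟩
  ((- 1ℚ) ÷′ (u * Gτ)) * (Gp ÷′ Gτ) * Gτ * u
    ≡⟨ normalized-weight Gτ Gp (ℚP.<⇒≢ (ℕ→ℚ-pos (ℕP.∸-monoˡ-≤ 1 (prime≥2 pp))) ∘ sym) ⟩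
  - (Gp ÷′ Gτ) ∎
  where
  open ≡-Reasoning
  u = ℕ→ℚ (p ℕ.∸ 1)
  Gτ = G τ z z₀
  Gp = G[ p ] z z₀ τ

In[-1,0] : ℚ → Set
In[-1,0] x = (- 1ℚ ≤ x) × (x ≤ 0ℚ)

lemma11 : (z₀ z : ℚ) (τ : ℕ) → ℕ→ℚ 2 ≤ z₀ → 1ℚ ≤ z → 1 ℕ.≤ τ → Coprime τ (P z₀) →
    (p : ℕ) → Prime p →
    (- 1ℚ ≤ w p z z₀ τ * G τ z z₀ * ℕ→ℚ (p ℕ.∸ 1)) × (w p z z₀ τ * G τ z z₀ * ℕ→ℚ (p ℕ.∸ 1) ≤ 0ℚ)
lemma11 z₀ z τ _ _ _ _ p pp = by-coprimality (coprime? p (τ ℕ.* P z₀))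
  where
  Gτ = G τ z z₀
  u = ℕ→ℚ (p ℕ.∸ 1)
  by-coprimality : Dec (Coprime p (τ ℕ.* P z₀)) → In[-1,0] (w p z z₀ τ * Gτ * u)
  by-coprimality (no ¬p⊥Q) = subst In[-1,0] (sym vanishes) (ℚP.neg-antimono-≤ 0≤1 , ℚP.≤-refl)
    where
    vanishes : w p z z₀ τ * Gτ * u ≡ 0ℚ
    vanishes = begin
      w p z z₀ τ * Gτ * u ≡⟨ cong (λ x → x * Gτ * u) (w-nonCoprime z₀ z τ ¬p⊥Q) ⟩
      0ℚ * Gτ * u         ≡⟨ cong (_* u) (ℚP.*-zeroˡ Gτ) ⟩
      0ℚ * u              ≡⟨ ℚP.*-zeroˡ u ⟩
      0ℚ                  ∎
      where open ≡-Reasoning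
  by-coprimality (yes p⊥Q) =
    subst In[-1,0] (sym (w*G*[p∸1]≡-G[p]÷′G z₀ z τ pp p⊥Q)) (ℚP.neg-antimono-≤ ratio≤1 , ℚP.neg-antimono-≤ 0≤ratio)
    where
    0≤ratio≤1 = ÷′-bounded (0≤G[p] z₀ z τ pp p⊥Q) (G[p]≤G z₀ z τ pp p⊥Q)
    0≤ratio = proj₁ 0≤ratio≤1
    ratio≤1 = proj₂ 0≤ratio≤1
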